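{- Let $m$ be a deficient number, let $e\ge 1$ be an integer, and let $p$ be a prime with $\gcd(m,p)=1$. Then $mp^e$ is a primitive abundant number if and only if all of the following hold: (a) $p^e/\sigma(p^{e-1}) < c(m)$; (b) for each prime power $q^\alpha\,\|\,m$, $$\frac{p^e}{\sigma(p^{e-1})} > \frac{\sigma(m)}{d(m) + \frac{2m}{\sigma(q^\alpha)-1}};$$ (c) either $e=1$, or $p^{e-1}/\sigma(p^{e-2}) > c(m)$.
   Context: For $n\in\mathbb{N}$, $\sigma(n)=\sum_{d\mid n}d$ (so $\sigma(1)=1$). $n$ is deficient if $\sigma(n)<2n$, perfect if $\sigma(n)=2n$, abundant if $\sigma(n)>2n$, and non-deficient if perfect or abundant. The deficiency is $d(n)=2n-\sigma(n)$ and the center of $n$ is $c(n)=\sigma(n)/d(n)$. A number is primitive non-deficient if it is non-deficient and all its proper divisors are deficient. A primitive abundant number is a primitive non-deficient number that is abundant. $q^\alpha\,\|\,m$ means $q^\alpha\mid m$ and $q^{\alpha+1}\nmid m$. -}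

module Defs where

open import Data.Nat as ℕ using (ℕ; _*_; _<_; _>_; _^_)
open import Data.Nat.Divisibility using (_∣_; _∣?_)
open import Data.List using (filter; upTo)
open import Data.Nat.ListAction using (sum)
open import Data.Product using (_×_)
open import Data.Integer as ℤ using (ℤ; +_)
open import Data.Rational as ℚ using (ℚ; 0ℚ; _÷_; ≢-nonZero)
open import Data.Rational.Properties using (_≟_)
open import Relation.Nullary using (¬_; yes; no)
open import Relation.Binary.PropositionalEquality using (_≢_)

-- sum of divisors: σ n = Σ_{d ∣ n} d  (σ 0 = 0 by this definition; irrelevant below)
σ : ℕ → ℕ
σ n = sum (filter (_∣? n) (upTo (ℕ.suc n)))

Deficient : ℕ → Set
Deficient n = σ n < 2 * n

Abundant : ℕ → Set
Abundant n = σ n > 2 * n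

NonDeficient : ℕ → Set
NonDeficient n = ¬ Deficient n

PrimitiveAbundant : ℕ → Set
PrimitiveAbundant n = Abundant n × (∀ k → k ∣ n → k ≢ n → Deficient k)

⟦_⟧ : ℕ → ℚ
⟦ n ⟧ = (+ n) ℚ./ 1

-- total division on ℚ (x / 0 := 0); only ever applied to positive denominators below
_//_ : ℚ → ℚ → ℚ
x // y with y ≟ 0ℚ
... | yes _ = 0ℚ
... | no y≢0 = _÷_ x y {{≢-nonZero y≢0}}

defi : ℕ → ℚ
defi n = ⟦ 2 * n ⟧ ℚ.- ⟦ σ n ⟧

center : ℕ → ℚ
center n = ⟦ σ n ⟧ // defi n

_^_∥_ : ℕ → ℕ → ℕ → Set
q ^ α ∥ m = (q ℕ.^ α) ∣ m × ¬ ((q ℕ.^ ℕ.suc α) ∣ m)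

-- σ is multiplicative and σ(p^e) = p^e + σ(p^(e-1)), so for deficient m and P coprime to m,
-- writing Q = σ(P) − P, the product mP is abundant iff P/Q < c(m) and deficient iff c(m) < P/Q.
-- Deficiency passes to divisors, hence m p^e is primitive abundant iff it is abundant and
-- m p^e / r is deficient for every prime divisor r. For r = p the cofactor is m p^(e-1),
-- which gives (c); for a prime q with q^α ∥ m it is (m/q) p^e, and the identity
-- σ(q^α) σ(m/q) = σ(q^(α-1)) σ(m) turns its deficiency into (b).

module Submission where

open import Defs

import Algebra.Properties.CommutativeSemigroup as CommutativeSemigroupProperties
open import Data.Empty using (⊥-elim)
import Data.Integer as ℤ
import Data.Integer.Properties as ℤ
open import Data.List using (List; []; _∷_; _++_; map; filter; upTo; cartesianProductWith)
open import Data.List.Membership.Propositional using (_∈_)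
open import Data.List.Membership.Propositional.Properties
  using (∈-∃++; ∈-map⁻; ∈-filter⁺; ∈-filter⁻; ∈-upTo⁺; ∈-cartesianProductWith⁺; ∈-cartesianProductWith⁻)
open import Data.List.Relation.Binary.Permutation.Propositional using (↭-sym)
open import Data.List.Relation.Binary.Permutation.Propositional.Properties using (∈-resp-↭; shift)
open import Data.List.Relation.Binary.Subset.Propositional using (_⊆_)
import Data.List.Relation.Unary.All as All
open import Data.List.Relation.Unary.Any using (here; there)
open import Data.List.Relation.Unary.Unique.Propositional using (Unique; []; _∷_)
import Data.List.Relation.Unary.Unique.Propositional.Properties as Unique
open import Data.Nat
open import Data.Nat.Coprimality using (Coprime; coprime-divisor; gcd≡1⇒coprime; 1-coprimeTo)
  renaming (sym to coprime-sym)
open import Data.Nat.Divisibility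
open import Data.Nat.GCD using (gcd; gcd[m,n]∣m; gcd[m,n]∣n; gcd[m,n]≢0; gcd-greatest; c*gcd[m,n]≡gcd[cm,cn])
open import Data.Nat.Induction using (<-wellFounded)
open import Data.Nat.ListAction using (sum; product)
open import Data.Nat.ListAction.Properties using (sum-↭; sum-++)
open import Data.Nat.Primality
  using (Prime; prime⇒nonZero; prime⇒nonTrivial; prime⇒irreducible; euclidsLemma)
open import Data.Nat.Primality.Factorisation using (factorise)
open import Data.Nat.Properties
open import Data.Nat.Tactic.RingSolver using (solve-∀)
open import Data.Product using (_×_; ∃₂; ∃-syntax; _,_; proj₂)
open import Data.Product.Function.NonDependent.Propositional using (_×-⇔_)
open import Data.Rational as ℚ using (ℚ; mkℚ; 0ℚ; 1ℚ)
import Data.Rational.Properties as ℚ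
open import Data.Sum using (_⊎_; inj₁; inj₂; [_,_])
open import Function.Base using (id)
open import Function.Bundles using (_⇔_; mk⇔; Equivalence)
import Function.Properties.Equivalence as ⇔
open import Induction.WellFounded using (Acc; acc)
open import Relation.Nullary using (¬_; yes; no)
open import Relation.Binary.PropositionalEquality
  using (_≡_; _≢_; refl; sym; trans; cong; cong₂; subst; subst₂; module ≡-Reasoning)

open CommutativeSemigroupProperties *-commutativeSemigroup using (x∙yz≈y∙xz; xy∙z≈y∙xz)

-- Divisor sums

sum-mono-⊆ : ∀ {xs ys : List ℕ} → Unique xs → xs ⊆ ys → sum xs ≤ sum ys
sum-mono-⊆ {[]} _ _ = z≤n
sum-mono-⊆ {x ∷ xs} {ys} x∷xs!@(_ ∷ xs!) xs⊆ys with ∈-∃++ (xs⊆ys (here refl))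
... | us , vs , refl = begin
  x + sum xs            ≤⟨ +-monoʳ-≤ x (sum-mono-⊆ xs! xs⊆us++vs) ⟩
  sum (x ∷ us ++ vs)    ≡⟨ sum-↭ (↭-sym (shift x us vs)) ⟩
  sum (us ++ x ∷ vs)    ∎
  where
  open ≤-Reasoning
  xs⊆us++vs : xs ⊆ us ++ vs
  xs⊆us++vs y∈xs with ∈-resp-↭ (shift x us vs) (xs⊆ys (there y∈xs))
  ... | here refl = ⊥-elim (Unique.Unique[x∷xs]⇒x∉xs x∷xs! y∈xs)
  ... | there y∈us++vs = y∈us++vs

sum-map-* : ∀ c (xs : List ℕ) → sum (map (c *_) xs) ≡ c * sum xs
sum-map-* c [] = sym (*-zeroʳ c)
sum-map-* c (x ∷ xs) = trans (cong (c * x +_) (sum-map-* c xs)) (sym (*-distribˡ-+ c x (sum xs)))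

sum-cartesianProductWith-* : ∀ (xs ys : List ℕ) → sum (cartesianProductWith _*_ xs ys) ≡ sum xs * sum ys
sum-cartesianProductWith-* [] ys = refl
sum-cartesianProductWith-* (x ∷ xs) ys = begin
  sum (map (x *_) ys ++ cartesianProductWith _*_ xs ys)    ≡⟨ sum-++ (map (x *_) ys) _ ⟩
  sum (map (x *_) ys) + sum (cartesianProductWith _*_ xs ys) ≡⟨ cong₂ _+_ (sum-map-* x ys) (sum-cartesianProductWith-* xs ys) ⟩
  x * sum ys + sum xs * sum ys                             ≡⟨ sym (*-distribʳ-+ (sum ys) x (sum xs)) ⟩
  (x + sum xs) * sum ys                                    ∎
  where open ≡-Reasoning

divisors : ℕ → List ℕ
divisors n = filter (_∣? n) (upTo (suc n))

divisors-unique : ∀ n → Unique (divisors n)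
divisors-unique n = Unique.filter⁺ (_∣? n) (Unique.upTo⁺ (suc n))

∈-divisors⁻ : ∀ {n d} → d ∈ divisors n → d ∣ n
∈-divisors⁻ {n} d∈ = proj₂ (∈-filter⁻ (_∣? n) {xs = upTo (suc n)} d∈)

∈-divisors⁺ : ∀ {n d} .{{_ : NonZero n}} → d ∣ n → d ∈ divisors n
∈-divisors⁺ {n} d∣n = ∈-filter⁺ (_∣? n) (∈-upTo⁺ (s≤s (∣⇒≤ d∣n))) d∣n

σ≡sum : ∀ n .{{_ : NonZero n}} {ds : List ℕ} → Unique ds →
        (∀ {d} → d ∈ ds → d ∣ n) → (∀ {d} → d ∣ n → d ∈ ds) → σ n ≡ sum ds
σ≡sum n ds! sound complete = ≤-antisym
  (sum-mono-⊆ (divisors-unique n) (λ d∈ → complete (∈-divisors⁻ d∈)))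
  (sum-mono-⊆ ds! (λ d∈ → ∈-divisors⁺ (sound d∈)))

n≤σ[n] : ∀ n .{{_ : NonZero n}} → n ≤ σ n
n≤σ[n] n = subst (_≤ σ n) (+-identityʳ n)
  (sum-mono-⊆ (All.[] ∷ []) λ { (here refl) → ∈-divisors⁺ ∣-refl })

σ≢0 : ∀ n .{{_ : NonZero n}} → NonZero (σ n)
σ≢0 n = >-nonZero (<-≤-trans (>-nonZero⁻¹ n) (n≤σ[n] n))

*-σ≤σ-* : ∀ k j .{{_ : NonZero k}} .{{_ : NonZero j}} → j * σ k ≤ σ (k * j)
*-σ≤σ-* k j = subst (_≤ σ (k * j)) (sum-map-* j (divisors k))
  (sum-mono-⊆ (Unique.map⁺ (*-cancelˡ-≡ _ _ j) (divisors-unique k)) scaled⊆divisors)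
  where
  instance _ = m*n≢0 k j
  scaled⊆divisors : map (j *_) (divisors k) ⊆ divisors (k * j)
  scaled⊆divisors x∈ with ∈-map⁻ (j *_) x∈
  ... | d , d∈ , refl = ∈-divisors⁺ (subst (j * d ∣_) (*-comm j k) (*-monoʳ-∣ j (∈-divisors⁻ d∈)))

deficient⇒nonZero : ∀ n → Deficient n → NonZero n
deficient⇒nonZero (suc n) _ = _

deficient-∣ : ∀ {d n} → d ∣ n → Deficient n → Deficient d
deficient-∣ {d} (divides j refl) σ[jd]<2jd = *-cancelˡ-< j (σ d) (2 * d) (begin-strict
  j * σ d      ≤⟨ *-σ≤σ-* d j ⟩
  σ (d * j)    ≡⟨ cong σ (*-comm d j) ⟩
  σ (j * d)    <⟨ σ[jd]<2jd ⟩
  2 * (j * d)  ≡⟨ x∙yz≈y∙xz 2 j d ⟩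
  j * (2 * d)  ∎)
  where
  open ≤-Reasoning
  instance
    _ = deficient⇒nonZero (j * d) σ[jd]<2jd
    _ = m*n≢0⇒m≢0 j
    _ = m*n≢0⇒n≢0 j

∣⇒nonZero : ∀ {d n} .{{_ : NonZero n}} → d ∣ n → NonZero d
∣⇒nonZero {zero} {n} (divides q eq) = ⊥-elim (≢-nonZero⁻¹ n (trans eq (*-zeroʳ q)))
∣⇒nonZero {suc _} _ = _

∣-coprime : ∀ {a b c d} → Coprime a b → c ∣ a → d ∣ b → Coprime c d
∣-coprime a⊥b c∣a d∣b (x∣c , x∣d) = a⊥b (∣-trans x∣c c∣a , ∣-trans x∣d d∣b)

-- x = g * (x / g) with g = gcd a x, and x / g divides b because x ∣ b * g = gcd (b * a) (b * x).
∣*-split : ∀ a b {x} .{{_ : NonZero a}} → x ∣ a * b → ∃₂ λ d e → d ∣ a × e ∣ b × x ≡ d * e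
∣*-split a b {x} x∣ab = g , quotient g∣x , gcd[m,n]∣m a x , x/g∣b , m∣n⇒n≡m*quotient g∣x
  where
  g = gcd a x
  g∣x = gcd[m,n]∣n a x
  instance _ = ≢-nonZero (gcd[m,n]≢0 a x (inj₁ (≢-nonZero⁻¹ a)))
  x∣b*g : x ∣ b * g
  x∣b*g = subst (x ∣_) (sym (c*gcd[m,n]≡gcd[cm,cn] b a x))
            (gcd-greatest (subst (x ∣_) (*-comm a b) x∣ab) (n∣m*n b))
  x/g∣b : quotient g∣x ∣ b
  x/g∣b = *-cancelˡ-∣ g (subst₂ _∣_ (m∣n⇒n≡m*quotient g∣x) (*-comm b g) x∣b*g)

coprime-factors-unique : ∀ {a b d d′ e e′} → Coprime a b → d ∣ a → d′ ∣ a → e ∣ b → e′ ∣ b →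
                         d * e ≡ d′ * e′ → d ≡ d′
coprime-factors-unique {d = d} {d′} {e} {e′} a⊥b d∣a d′∣a e∣b e′∣b de≡d′e′ = ∣-antisym
  (coprime-divisor (∣-coprime a⊥b d∣a e′∣b) (subst (d ∣_) (trans de≡d′e′ (*-comm d′ e′)) (m∣m*n e)))
  (coprime-divisor (∣-coprime a⊥b d′∣a e∣b) (subst (d′ ∣_) (trans (sym de≡d′e′) (*-comm d e)) (m∣m*n e′)))

cartesianProduct-*-unique : ∀ {a b} .{{_ : NonZero a}} → Coprime a b → ∀ {xs ys} →
  Unique xs → Unique ys → (∀ {x} → x ∈ xs → x ∣ a) → (∀ {y} → y ∈ ys → y ∣ b) →
  Unique (cartesianProductWith _*_ xs ys)
cartesianProduct-*-unique a⊥b {[]} _ _ _ _ = []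
cartesianProduct-*-unique a⊥b {x ∷ xs} {ys} x∷xs!@(_ ∷ xs!) ys! xs∣a ys∣b =
  Unique.++⁺ (Unique.map⁺ (*-cancelˡ-≡ _ _ x) ys!)
             (cartesianProduct-*-unique a⊥b {xs} xs! ys! (λ x′∈ → xs∣a (there x′∈)) ys∣b)
             disjoint
  where
  instance _ = ∣⇒nonZero (xs∣a (here refl))
  disjoint : ∀ {v} → ¬ (v ∈ map (x *_) ys × v ∈ cartesianProductWith _*_ xs ys)
  disjoint (v∈xys , v∈xsys) with ∈-map⁻ (x *_) v∈xys | ∈-cartesianProductWith⁻ _*_ xs ys v∈xsys
  ... | y , y∈ , refl | x′ , y′ , x′∈ , y′∈ , xy≡x′y′
    with refl ← coprime-factors-unique a⊥b (xs∣a (here refl)) (xs∣a (there x′∈)) (ys∣b y∈) (ys∣b y′∈) xy≡x′y′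
    = Unique.Unique[x∷xs]⇒x∉xs x∷xs! x′∈

σ-multiplicative : ∀ a b .{{_ : NonZero a}} .{{_ : NonZero b}} → Coprime a b → σ (a * b) ≡ σ a * σ b
σ-multiplicative a b a⊥b = trans
  (σ≡sum (a * b) {{m*n≢0 a b}}
    (cartesianProduct-*-unique a⊥b (divisors-unique a) (divisors-unique b) ∈-divisors⁻ ∈-divisors⁻)
    sound complete)
  (sum-cartesianProductWith-* (divisors a) (divisors b))
  where
  sound : ∀ {x} → x ∈ cartesianProductWith _*_ (divisors a) (divisors b) → x ∣ a * b
  sound x∈ with ∈-cartesianProductWith⁻ _*_ (divisors a) (divisors b) x∈
  ... | d , e , d∈ , e∈ , refl = *-pres-∣ (∈-divisors⁻ {a} d∈) (∈-divisors⁻ {b} e∈)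
  complete : ∀ {x} → x ∣ a * b → x ∈ cartesianProductWith _*_ (divisors a) (divisors b)
  complete x∣ab with ∣*-split a b x∣ab
  ... | d , e , d∣a , e∣b , refl = ∈-cartesianProductWith⁺ _*_ (∈-divisors⁺ d∣a) (∈-divisors⁺ e∣b)

-- Prime powers

prime>1 : ∀ {p} → Prime p → 1 < p
prime>1 {p} p-prime = nonTrivial⇒n>1 p {{prime⇒nonTrivial p-prime}}

prime∤⇒coprime : ∀ {p x} → Prime p → ¬ p ∣ x → Coprime p x
prime∤⇒coprime p-prime p∤x (d∣p , d∣x) with prime⇒irreducible p-prime d∣p
... | inj₁ d≡1 = d≡1
... | inj₂ refl = ⊥-elim (p∤x d∣x)

coprime-^ʳ : ∀ {a p} → Coprime a p → ∀ k → Coprime a (p ^ k)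
coprime-^ʳ a⊥p zero (_ , d∣1) = ∣1⇒≡1 d∣1
coprime-^ʳ a⊥p (suc k) (d∣a , d∣p*p^k) =
  coprime-^ʳ a⊥p k (d∣a , coprime-divisor (∣-coprime a⊥p d∣a ∣-refl) d∣p*p^k)

prime∣p^k⇒≡ : ∀ {r p} → Prime r → Prime p → ∀ k → r ∣ p ^ k → r ≡ p
prime∣p^k⇒≡ r-prime p-prime zero r∣1 = ⊥-elim (<⇒≢ (prime>1 r-prime) (sym (∣1⇒≡1 r∣1)))
prime∣p^k⇒≡ {r} {p} r-prime p-prime (suc k) r∣p*p^k with euclidsLemma p (p ^ k) r-prime r∣p*p^k
... | inj₂ r∣p^k = prime∣p^k⇒≡ r-prime p-prime k r∣p^k
... | inj₁ r∣p with prime⇒irreducible p-prime r∣p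
...   | inj₂ r≡p = r≡p
...   | inj₁ refl = ⊥-elim (<-irrefl refl (prime>1 r-prime))

∣p^[1+k]⇒∣p^k⊎≡ : ∀ {p} → Prime p → ∀ k {x} → x ∣ p ^ suc k → x ∣ p ^ k ⊎ x ≡ p ^ suc k
∣p^[1+k]⇒∣p^k⊎≡ {p} p-prime k {x} x∣p^[1+k] with p ∣? x
... | no p∤x = inj₁ (coprime-divisor (coprime-sym (prime∤⇒coprime p-prime p∤x)) x∣p^[1+k])
... | yes (divides y refl) = multiply-by-p k (*-cancelʳ-∣ p (subst (y * p ∣_) (*-comm p (p ^ k)) x∣p^[1+k]))
  where
  instance _ = prime⇒nonZero p-prime
  multiply-by-p : ∀ k → y ∣ p ^ k → y * p ∣ p ^ k ⊎ y * p ≡ p ^ suc k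
  multiply-by-p zero y∣1 rewrite ∣1⇒≡1 y∣1 = inj₂ (*-comm 1 p)
  multiply-by-p (suc j) y∣p^[1+j] with ∣p^[1+k]⇒∣p^k⊎≡ p-prime j y∣p^[1+j]
  ... | inj₁ y∣p^j = inj₁ (subst (y * p ∣_) (*-comm (p ^ j) p) (*-monoˡ-∣ p y∣p^j))
  ... | inj₂ refl  = inj₂ (*-comm (p ^ suc j) p)

σ[p^[1+k]]≡p^[1+k]+σ[p^k] : ∀ {p} → Prime p → ∀ k → σ (p ^ suc k) ≡ p ^ suc k + σ (p ^ k)
σ[p^[1+k]]≡p^[1+k]+σ[p^k] {p} p-prime k =
  σ≡sum (p ^ suc k) (p^[1+k]∉ ∷ divisors-unique (p ^ k)) sound complete
  where
  instance
    _ = prime⇒nonZero p-prime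
    _ = m^n≢0 p k
    _ = m^n≢0 p (suc k)
  p^k<p^[1+k] : p ^ k < p ^ suc k
  p^k<p^[1+k] = subst (_< p * p ^ k) (*-identityˡ (p ^ k)) (*-monoˡ-< (p ^ k) (prime>1 p-prime))
  p^[1+k]∉ : All.All (p ^ suc k ≢_) (divisors (p ^ k))
  p^[1+k]∉ = All.tabulate λ d∈ p^[1+k]≡d →
    <⇒≱ p^k<p^[1+k] (subst (_≤ p ^ k) (sym p^[1+k]≡d) (∣⇒≤ (∈-divisors⁻ d∈)))
  sound : ∀ {d} → d ∈ p ^ suc k ∷ divisors (p ^ k) → d ∣ p ^ suc k
  sound (here refl) = ∣-refl
  sound (there d∈) = ∣n⇒∣m*n p (∈-divisors⁻ d∈)
  complete : ∀ {d} → d ∣ p ^ suc k → d ∈ p ^ suc k ∷ divisors (p ^ k)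
  complete d∣p^[1+k] with ∣p^[1+k]⇒∣p^k⊎≡ p-prime k d∣p^[1+k]
  ... | inj₁ d∣p^k = there (∈-divisors⁺ d∣p^k)
  ... | inj₂ refl  = here refl

σ[p^[1+k]]≡1+p*σ[p^k] : ∀ {p} → Prime p → ∀ k → σ (p ^ suc k) ≡ 1 + p * σ (p ^ k)
σ[p^[1+k]]≡1+p*σ[p^k] {p} p-prime zero = trans (σ[p^[1+k]]≡p^[1+k]+σ[p^k] p-prime zero) (+-comm (p * 1) 1)
σ[p^[1+k]]≡1+p*σ[p^k] {p} p-prime (suc k) = begin
  σ (p ^ suc (suc k))                 ≡⟨ σ[p^[1+k]]≡p^[1+k]+σ[p^k] p-prime (suc k) ⟩
  p * p ^ suc k + σ (p ^ suc k)       ≡⟨ cong (p * p ^ suc k +_) (σ[p^[1+k]]≡1+p*σ[p^k] p-prime k) ⟩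
  p * p ^ suc k + (1 + p * σ (p ^ k)) ≡⟨ shuffle p (p ^ suc k) (σ (p ^ k)) ⟩
  1 + p * (p ^ suc k + σ (p ^ k))     ≡⟨ cong (λ s → 1 + p * s) (σ[p^[1+k]]≡p^[1+k]+σ[p^k] p-prime k) ⟨
  1 + p * σ (p ^ suc k)               ∎
  where
  open ≡-Reasoning
  shuffle : ∀ a b c → a * b + (1 + a * c) ≡ 1 + a * (b + c)
  shuffle = solve-∀

σ[q^[1+α]]σ[q^αn]≡σ[q^α]σ[q^[1+α]n] : ∀ {q n} α .{{_ : NonZero n}} → Prime q → ¬ q ∣ n →
  σ (q ^ suc α) * σ (q ^ α * n) ≡ σ (q ^ α) * σ (q ^ suc α * n)
σ[q^[1+α]]σ[q^αn]≡σ[q^α]σ[q^[1+α]n] {q} {n} α q-prime q∤n = begin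
  σ (q ^ suc α) * σ (q ^ α * n)          ≡⟨ cong (σ (q ^ suc α) *_) (σ-multiplicative (q ^ α) n (q^k⊥n α)) ⟩
  σ (q ^ suc α) * (σ (q ^ α) * σ n)      ≡⟨ x∙yz≈y∙xz (σ (q ^ suc α)) (σ (q ^ α)) (σ n) ⟩
  σ (q ^ α) * (σ (q ^ suc α) * σ n)      ≡⟨ cong (σ (q ^ α) *_) (σ-multiplicative (q ^ suc α) n (q^k⊥n (suc α))) ⟨
  σ (q ^ α) * σ (q ^ suc α * n)          ∎
  where
  open ≡-Reasoning
  instance
    _ = prime⇒nonZero q-prime
    _ = m^n≢0 q α
    _ = m^n≢0 q (suc α)
  q^k⊥n : ∀ k → Coprime (q ^ k) n
  q^k⊥n k = coprime-sym (coprime-^ʳ (coprime-sym (prime∤⇒coprime q-prime q∤n)) k)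

prime-factor : ∀ {n} → 1 < n → ∃[ r ] Prime r × r ∣ n
prime-factor {n} 1<n with factorise n {{>-nonZero (<-trans z<s 1<n)}}
... | record { factors = [] ; isFactorisation = n≡1 } = ⊥-elim (<⇒≢ 1<n (sym n≡1))
... | record { factors = r ∷ rs ; isFactorisation = n≡r*rs ; factorsPrime = r-prime All.∷ _ } =
  r , r-prime , divides (product rs) (trans n≡r*rs (*-comm r (product rs)))

exact-power : ∀ {r} → Prime r → ∀ n .{{_ : NonZero n}} → ∃₂ λ α n′ → n ≡ r ^ α * n′ × ¬ r ∣ n′
exact-power {r} r-prime n = go n (<-wellFounded n)
  where
  instance _ = prime⇒nonZero r-prime
  go : ∀ n .{{_ : NonZero n}} → Acc _<_ n → ∃₂ λ α n′ → n ≡ r ^ α * n′ × ¬ r ∣ n′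
  go n (acc rec) with r ∣? n
  ... | no r∤n = 0 , n , sym (*-identityˡ n) , r∤n
  ... | yes (divides m refl) with go m {{m*n≢0⇒m≢0 m}} (rec (m<m*n m r {{m*n≢0⇒m≢0 m}} (prime>1 r-prime)))
  ...   | α , n′ , refl , r∤n′ = suc α , n′ , shuffle r (r ^ α) n′ , r∤n′
    where
    shuffle : ∀ r s n′ → s * n′ * r ≡ r * s * n′
    shuffle = solve-∀

∥⇒exact : ∀ {q α n} → q ^ α ∥ n → ∃[ n′ ] n ≡ q ^ α * n′ × ¬ q ∣ n′
∥⇒exact {q} {α} (divides n′ n≡n′*q^α , q^[1+α]∤n) = n′ , trans n≡n′*q^α (*-comm n′ (q ^ α)) , q∤n′
  where
  q∤n′ : ¬ q ∣ n′
  q∤n′ (divides c refl) = q^[1+α]∤n (divides c (trans n≡n′*q^α (*-assoc c q (q ^ α))))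

exact⇒∥ : ∀ {q α n n′} .{{_ : NonZero q}} → n ≡ q ^ α * n′ → ¬ q ∣ n′ → q ^ α ∥ n
exact⇒∥ {q} {α} {n′ = n′} refl q∤n′ = divides n′ (*-comm (q ^ α) n′) , λ q^[1+α]∣ →
  q∤n′ (*-cancelˡ-∣ (q ^ α) {{m^n≢0 q α}} (subst (_∣ q ^ α * n′) (*-comm q (q ^ α)) q^[1+α]∣))

p^[1+e]≡r*k⇒r≡p×k≡p^e : ∀ {p r k} e → Prime p → Prime r → p ^ suc e ≡ r * k → r ≡ p × k ≡ p ^ e
p^[1+e]≡r*k⇒r≡p×k≡p^e {p} {r} {k} e p-prime r-prime p^[1+e]≡r*k
  with refl ← prime∣p^k⇒≡ r-prime p-prime (suc e) (divides k (trans p^[1+e]≡r*k (*-comm r k)))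
  = refl , *-cancelˡ-≡ k (p ^ e) p {{prime⇒nonZero p-prime}} (sym p^[1+e]≡r*k)

-- Primitivity

ProperDivisorsDeficient : ℕ → Set
ProperDivisorsDeficient n = ∀ k → k ∣ n → k ≢ n → Deficient k

PrimeCofactorsDeficient : ℕ → Set
PrimeCofactorsDeficient n = ∀ r k → Prime r → n ≡ r * k → Deficient k

properDivisors⇔primeCofactors : ∀ n .{{_ : NonZero n}} →
  ProperDivisorsDeficient n ⇔ PrimeCofactorsDeficient n
properDivisors⇔primeCofactors n = mk⇔ to from
  where
  to : ProperDivisorsDeficient n → PrimeCofactorsDeficient n
  to proper r k r-prime refl = proper k (n∣m*n r) k≢rk
    where
    instance _ = m*n≢0⇒n≢0 r
    k≢rk : k ≢ r * k
    k≢rk k≡rk = <⇒≢ (subst (k <_) (*-comm k r) (m<m*n k r (prime>1 r-prime))) k≡rk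
  from : PrimeCofactorsDeficient n → ProperDivisorsDeficient n
  from cofactors k (divides zero n≡0) _ = ⊥-elim (≢-nonZero⁻¹ n n≡0)
  from cofactors k (divides 1 n≡k+0) k≢n = ⊥-elim (k≢n (sym (trans n≡k+0 (+-identityʳ k))))
  from cofactors k (divides j@(suc (suc _)) n≡jk) _ with prime-factor {j} (s≤s (s≤s z≤n))
  ... | r , r-prime , divides j′ j≡j′r = deficient-∣ (n∣m*n j′) (cofactors r (j′ * k) r-prime n≡r*j′k)
    where
    n≡r*j′k : n ≡ r * (j′ * k)
    n≡r*j′k = trans n≡jk (trans (cong (_* k) j≡j′r) (xy∙z≈y∙xz j′ r k))

primeCofactors-*⇔ : ∀ a b → PrimeCofactorsDeficient (a * b) ⇔
  ((∀ r k → Prime r → a ≡ r * k → Deficient (k * b)) × (∀ r k → Prime r → b ≡ r * k → Deficient (a * k)))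
primeCofactors-*⇔ a b = mk⇔
  (λ cofactors → (λ { r k r-prime refl → cofactors r (k * b) r-prime (*-assoc r k b) })
               , (λ { r k r-prime refl → cofactors r (a * k) r-prime (x∙yz≈y∙xz a r k) }))
  from
  where
  from : (∀ r k → Prime r → a ≡ r * k → Deficient (k * b)) × (∀ r k → Prime r → b ≡ r * k → Deficient (a * k)) →
         PrimeCofactorsDeficient (a * b)
  from (cofactorsˡ , cofactorsʳ) r k r-prime ab≡rk
    with euclidsLemma a b r-prime (divides k (trans ab≡rk (*-comm r k)))
  ... | inj₁ (divides a′ refl) = subst Deficient (*-cancelˡ-≡ _ _ r {{prime⇒nonZero r-prime}}
          (trans (sym (xy∙z≈y∙xz a′ r b)) ab≡rk)) (cofactorsˡ r a′ r-prime (*-comm a′ r))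
  ... | inj₂ (divides b′ refl) = subst Deficient (*-cancelˡ-≡ _ _ r {{prime⇒nonZero r-prime}}
          (trans (sym (x∙yz≈y∙xz a r b′)) (trans (cong (a *_) (*-comm r b′)) ab≡rk)))
          (cofactorsʳ r b′ r-prime (*-comm b′ r))

-- Fractions of natural numbers

⟦⟧≡mkℚ : ∀ n → ⟦ n ⟧ ≡ mkℚ (ℤ.+ n) 0 (coprime-sym (1-coprimeTo n))
⟦⟧≡mkℚ n = ℚ.normalize-coprime (coprime-sym (1-coprimeTo n))

⟦⟧-homo-+ : ∀ m n → ⟦ m ⟧ ℚ.+ ⟦ n ⟧ ≡ ⟦ m + n ⟧
⟦⟧-homo-+ m n rewrite ⟦⟧≡mkℚ m | ⟦⟧≡mkℚ n = ℚ./-cong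
  (trans (cong₂ ℤ._+_ (ℤ.*-identityʳ (ℤ.+ m)) (ℤ.*-identityʳ (ℤ.+ n))) (sym (ℤ.pos-+ m n))) refl

⟦⟧-homo-* : ∀ m n → ⟦ m ⟧ ℚ.* ⟦ n ⟧ ≡ ⟦ m * n ⟧
⟦⟧-homo-* m n rewrite ⟦⟧≡mkℚ m | ⟦⟧≡mkℚ n = ℚ./-cong (sym (ℤ.pos-* m n)) refl

⟦⟧-<⇔ : ∀ m n → ⟦ m ⟧ ℚ.< ⟦ n ⟧ ⇔ m < n
⟦⟧-<⇔ m n rewrite ⟦⟧≡mkℚ m | ⟦⟧≡mkℚ n = mk⇔
  (λ { (ℚ.*<* m*1<n*1) → ℤ.drop‿+<+ (subst₂ ℤ._<_ (ℤ.*-identityʳ (ℤ.+ m)) (ℤ.*-identityʳ (ℤ.+ n)) m*1<n*1) })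
  (λ m<n → ℚ.*<* (subst₂ ℤ._<_ (sym (ℤ.*-identityʳ (ℤ.+ m))) (sym (ℤ.*-identityʳ (ℤ.+ n))) (ℤ.+<+ m<n)))

⟦⟧-positive : ∀ n .{{_ : NonZero n}} → ℚ.Positive ⟦ n ⟧
⟦⟧-positive (suc n) rewrite ⟦⟧≡mkℚ (suc n) = _

⟦⟧≢0 : ∀ n .{{_ : NonZero n}} → ⟦ n ⟧ ≢ 0ℚ
⟦⟧≢0 n ⟦n⟧≡0 = ℚ.<-irrefl (sym ⟦n⟧≡0) (ℚ.positive⁻¹ ⟦ n ⟧ {{⟦⟧-positive n}})

⟦m+n⟧-⟦m⟧≡⟦n⟧ : ∀ m n → ⟦ m + n ⟧ ℚ.- ⟦ m ⟧ ≡ ⟦ n ⟧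
⟦m+n⟧-⟦m⟧≡⟦n⟧ m n = begin
  ⟦ m + n ⟧ ℚ.- ⟦ m ⟧             ≡⟨ cong (ℚ._- ⟦ m ⟧) (⟦⟧-homo-+ m n) ⟨
  ⟦ m ⟧ ℚ.+ ⟦ n ⟧ ℚ.- ⟦ m ⟧       ≡⟨ cong (ℚ._- ⟦ m ⟧) (ℚ.+-comm ⟦ m ⟧ ⟦ n ⟧) ⟩
  ⟦ n ⟧ ℚ.+ ⟦ m ⟧ ℚ.- ⟦ m ⟧       ≡⟨ ℚ.+-assoc ⟦ n ⟧ ⟦ m ⟧ (ℚ.- ⟦ m ⟧) ⟩
  ⟦ n ⟧ ℚ.+ (⟦ m ⟧ ℚ.- ⟦ m ⟧)     ≡⟨ cong (⟦ n ⟧ ℚ.+_) (ℚ.+-inverseʳ ⟦ m ⟧) ⟩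
  ⟦ n ⟧ ℚ.+ 0ℚ                    ≡⟨ ℚ.+-identityʳ ⟦ n ⟧ ⟩
  ⟦ n ⟧                           ∎
  where open ≡-Reasoning

//-*-cancel : ∀ x {y} → y ≢ 0ℚ → (x // y) ℚ.* y ≡ x
//-*-cancel x {y} y≢0 with y ℚ.≟ 0ℚ
... | yes y≡0 = ⊥-elim (y≢0 y≡0)
... | no _ = begin
  x ℚ.* ℚ.1/ y ℚ.* y      ≡⟨ ℚ.*-assoc x (ℚ.1/ y) y ⟩
  x ℚ.* (ℚ.1/ y ℚ.* y)    ≡⟨ cong (x ℚ.*_) (ℚ.*-inverseˡ y) ⟩
  x ℚ.* 1ℚ                ≡⟨ ℚ.*-identityʳ x ⟩
  x                       ∎
  where
  open ≡-Reasoning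
  instance _ = ℚ.≢-nonZero y≢0

*-//-cancel : ∀ x {y} → y ≢ 0ℚ → (x ℚ.* y) // y ≡ x
*-//-cancel x {y} y≢0 with y ℚ.≟ 0ℚ
... | yes y≡0 = ⊥-elim (y≢0 y≡0)
... | no _ = begin
  x ℚ.* y ℚ.* ℚ.1/ y      ≡⟨ ℚ.*-assoc x y (ℚ.1/ y) ⟩
  x ℚ.* (y ℚ.* ℚ.1/ y)    ≡⟨ cong (x ℚ.*_) (ℚ.*-inverseʳ y) ⟩
  x ℚ.* 1ℚ                ≡⟨ ℚ.*-identityʳ x ⟩
  x                       ∎
  where
  open ≡-Reasoning
  instance _ = ℚ.≢-nonZero y≢0

ℚ-*-cancelʳ-≡ : ∀ u v {y} → y ≢ 0ℚ → u ℚ.* y ≡ v ℚ.* y → u ≡ v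
ℚ-*-cancelʳ-≡ u v {y} y≢0 uy≡vy = trans (sym (*-//-cancel u y≢0)) (trans (cong (_// y) uy≡vy) (*-//-cancel v y≢0))

frac : ℕ → ℕ → ℚ
frac a b = ⟦ a ⟧ // ⟦ b ⟧

frac-*-cancel : ∀ a b .{{_ : NonZero b}} → frac a b ℚ.* ⟦ b ⟧ ≡ ⟦ a ⟧
frac-*-cancel a b = //-*-cancel ⟦ a ⟧ (⟦⟧≢0 b)

frac≢0 : ∀ a b .{{_ : NonZero a}} .{{_ : NonZero b}} → frac a b ≢ 0ℚ
frac≢0 a b frac≡0 = ⟦⟧≢0 a (begin
  ⟦ a ⟧                ≡⟨ frac-*-cancel a b ⟨
  frac a b ℚ.* ⟦ b ⟧   ≡⟨ cong (ℚ._* ⟦ b ⟧) frac≡0 ⟩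
  0ℚ ℚ.* ⟦ b ⟧         ≡⟨ ℚ.*-zeroˡ ⟦ b ⟧ ⟩
  0ℚ                   ∎)
  where open ≡-Reasoning

frac-<⇔ : ∀ a b c d .{{_ : NonZero b}} .{{_ : NonZero d}} → frac a b ℚ.< frac c d ⇔ a * d < c * b
frac-<⇔ a b c d = mk⇔
  (λ lt → Equivalence.to (⟦⟧-<⇔ (a * d) (c * b))
             (subst₂ ℚ._<_ (scale a b d) (scale′ c d b) (ℚ.*-monoˡ-<-pos ⟦ b * d ⟧ lt)))
  (λ lt → ℚ.*-cancelʳ-<-nonNeg ⟦ b * d ⟧
             (subst₂ ℚ._<_ (sym (scale a b d)) (sym (scale′ c d b)) (Equivalence.from (⟦⟧-<⇔ (a * d) (c * b)) lt)))
  where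
  instance
    _ = m*n≢0 b d
    _ = ⟦⟧-positive (b * d)
    _ = ℚ.pos⇒nonNeg ⟦ b * d ⟧
  scale : ∀ x y z .{{_ : NonZero y}} → frac x y ℚ.* ⟦ y * z ⟧ ≡ ⟦ x * z ⟧
  scale x y z = begin
    frac x y ℚ.* ⟦ y * z ⟧             ≡⟨ cong (frac x y ℚ.*_) (⟦⟧-homo-* y z) ⟨
    frac x y ℚ.* (⟦ y ⟧ ℚ.* ⟦ z ⟧)     ≡⟨ ℚ.*-assoc (frac x y) ⟦ y ⟧ ⟦ z ⟧ ⟨
    frac x y ℚ.* ⟦ y ⟧ ℚ.* ⟦ z ⟧       ≡⟨ cong (ℚ._* ⟦ z ⟧) (frac-*-cancel x y) ⟩
    ⟦ x ⟧ ℚ.* ⟦ z ⟧                    ≡⟨ ⟦⟧-homo-* x z ⟩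
    ⟦ x * z ⟧                          ∎
    where open ≡-Reasoning
  scale′ : ∀ x y z .{{_ : NonZero y}} → frac x y ℚ.* ⟦ z * y ⟧ ≡ ⟦ x * z ⟧
  scale′ x y z = trans (cong (λ n → frac x y ℚ.* ⟦ n ⟧) (*-comm z y)) (scale x y z)

⟦⟧+frac : ∀ x y t .{{_ : NonZero t}} → ⟦ x ⟧ ℚ.+ frac y t ≡ frac (x * t + y) t
⟦⟧+frac x y t = sym (trans (cong (_// ⟦ t ⟧) (sym numerator)) (*-//-cancel _ (⟦⟧≢0 t)))
  where
  open ≡-Reasoning
  numerator : (⟦ x ⟧ ℚ.+ frac y t) ℚ.* ⟦ t ⟧ ≡ ⟦ x * t + y ⟧
  numerator = begin
    (⟦ x ⟧ ℚ.+ frac y t) ℚ.* ⟦ t ⟧           ≡⟨ ℚ.*-distribʳ-+ ⟦ t ⟧ ⟦ x ⟧ (frac y t) ⟩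
    ⟦ x ⟧ ℚ.* ⟦ t ⟧ ℚ.+ frac y t ℚ.* ⟦ t ⟧   ≡⟨ cong₂ ℚ._+_ (⟦⟧-homo-* x t) (frac-*-cancel y t) ⟩
    ⟦ x * t ⟧ ℚ.+ ⟦ y ⟧                      ≡⟨ ⟦⟧-homo-+ (x * t) y ⟩
    ⟦ x * t + y ⟧                            ∎

⟦⟧//frac : ∀ s x t .{{_ : NonZero x}} .{{_ : NonZero t}} → ⟦ s ⟧ // frac x t ≡ frac (s * t) x
⟦⟧//frac s x t = trans (cong (_// frac x t) (sym reciprocal)) (*-//-cancel _ (frac≢0 x t))
  where
  open ≡-Reasoning
  reciprocal : frac (s * t) x ℚ.* frac x t ≡ ⟦ s ⟧
  reciprocal = ℚ-*-cancelʳ-≡ _ _ (⟦⟧≢0 t) (begin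
    frac (s * t) x ℚ.* frac x t ℚ.* ⟦ t ⟧     ≡⟨ ℚ.*-assoc (frac (s * t) x) (frac x t) ⟦ t ⟧ ⟩
    frac (s * t) x ℚ.* (frac x t ℚ.* ⟦ t ⟧)   ≡⟨ cong (frac (s * t) x ℚ.*_) (frac-*-cancel x t) ⟩
    frac (s * t) x ℚ.* ⟦ x ⟧                  ≡⟨ frac-*-cancel (s * t) x ⟩
    ⟦ s * t ⟧                                 ≡⟨ ⟦⟧-homo-* s t ⟨
    ⟦ s ⟧ ℚ.* ⟦ t ⟧                           ∎)

<-respʳ-≡⇔ : ∀ {x y z : ℚ} → y ≡ z → x ℚ.< y ⇔ x ℚ.< z
<-respʳ-≡⇔ refl = ⇔.refl

<-respˡ-≡⇔ : ∀ {x y z : ℚ} → x ≡ y → x ℚ.< z ⇔ y ℚ.< z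
<-respˡ-≡⇔ refl = ⇔.refl

-- Deficient numbers times a coprime multiplier

deficiency : ℕ → ℕ
deficiency n = 2 * n ∸ σ n

σ+deficiency≡2n : ∀ n → Deficient n → σ n + deficiency n ≡ 2 * n
σ+deficiency≡2n n n-deficient = m+[n∸m]≡n (<⇒≤ n-deficient)

deficiency≢0 : ∀ n → Deficient n → NonZero (deficiency n)
deficiency≢0 n n-deficient = >-nonZero (m<n⇒0<n∸m n-deficient)

defi≡⟦deficiency⟧ : ∀ n → Deficient n → defi n ≡ ⟦ deficiency n ⟧
defi≡⟦deficiency⟧ n n-deficient = trans
  (cong (λ k → ⟦ k ⟧ ℚ.- ⟦ σ n ⟧) (sym (σ+deficiency≡2n n n-deficient)))
  (⟦m+n⟧-⟦m⟧≡⟦n⟧ (σ n) (deficiency n))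

center≡frac : ∀ n → Deficient n → center n ≡ frac (σ n) (deficiency n)
center≡frac n n-deficient = cong (⟦ σ n ⟧ //_) (defi≡⟦deficiency⟧ n n-deficient)

scale-shift-<⇔ : ∀ c d {x y x′ y′} .{{_ : NonZero c}} →
  c * x ≡ x′ + d → c * y ≡ y′ + d → x < y ⇔ x′ < y′
scale-shift-<⇔ c d {x} {y} {x′} {y′} cx≡x′+d cy≡y′+d = mk⇔
  (λ x<y → +-cancelʳ-< d x′ y′ (subst₂ _<_ cx≡x′+d cy≡y′+d (*-monoʳ-< c x<y)))
  (λ x′<y′ → *-cancelˡ-< c x y (subst₂ _<_ (sym cx≡x′+d) (sym cy≡y′+d) (+-monoˡ-< d x′<y′)))

ConditionB : ℕ → ℚ → Set
ConditionB m x = ∀ q α → Prime q → 1 ≤ α → q ^ α ∥ m →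
  ⟦ σ m ⟧ // (defi m ℚ.+ (⟦ 2 * m ⟧ // (⟦ σ (q ^ α) ⟧ ℚ.- ⟦ 1 ⟧))) ℚ.< x

conditionB-bound≡frac : ∀ m {q} α → Deficient m → Prime q →
  ⟦ σ m ⟧ // (defi m ℚ.+ (⟦ 2 * m ⟧ // (⟦ σ (q ^ suc α) ⟧ ℚ.- ⟦ 1 ⟧)))
    ≡ frac (σ m * (q * σ (q ^ α))) (deficiency m * (q * σ (q ^ α)) + 2 * m)
conditionB-bound≡frac m {q} α m-deficient q-prime = begin
  ⟦ σ m ⟧ // (defi m ℚ.+ (⟦ 2 * m ⟧ // (⟦ σ (q ^ suc α) ⟧ ℚ.- ⟦ 1 ⟧)))
    ≡⟨ cong₂ (λ x y → ⟦ σ m ⟧ // (x ℚ.+ (⟦ 2 * m ⟧ // y))) (defi≡⟦deficiency⟧ m m-deficient) σ[q^[1+α]]-1≡t ⟩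
  ⟦ σ m ⟧ // (⟦ δ ⟧ ℚ.+ frac (2 * m) t)
    ≡⟨ cong (⟦ σ m ⟧ //_) (⟦⟧+frac δ (2 * m) t) ⟩
  ⟦ σ m ⟧ // frac (δ * t + 2 * m) t
    ≡⟨ ⟦⟧//frac (σ m) (δ * t + 2 * m) t ⟩
  frac (σ m * t) (δ * t + 2 * m)      ∎
  where
  open ≡-Reasoning
  δ = deficiency m
  t = q * σ (q ^ α)
  instance
    _ = prime⇒nonZero q-prime
    _ = deficient⇒nonZero m m-deficient
    _ = m^n≢0 q α
    _ = σ≢0 (q ^ α)
    _ = m*n≢0 q (σ (q ^ α))
    _ = >-nonZero (<-≤-trans (>-nonZero⁻¹ (2 * m) {{m*n≢0 2 m}}) (m≤n+m (2 * m) (δ * t)))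
  σ[q^[1+α]]-1≡t : ⟦ σ (q ^ suc α) ⟧ ℚ.- ⟦ 1 ⟧ ≡ ⟦ t ⟧
  σ[q^[1+α]]-1≡t = trans (cong (λ x → ⟦ x ⟧ ℚ.- ⟦ 1 ⟧) (σ[p^[1+k]]≡1+p*σ[p^k] q-prime α)) (⟦m+n⟧-⟦m⟧≡⟦n⟧ 1 t)

-- P stands for p^e and Q for σ(p^(e-1)) = σ(P) − P.
module _ {m P Q : ℕ} .{{_ : NonZero P}} .{{_ : NonZero Q}}
         (m-deficient : Deficient m) (m⊥P : Coprime m P) (σ[P]≡P+Q : σ P ≡ P + Q) where

  private
    S = σ m
    δ = deficiency m
    instance
      _ = deficient⇒nonZero m m-deficient
      _ = deficiency≢0 m m-deficient

    σ[mP]≡SQ+SP : 1 * σ (m * P) ≡ S * Q + S * P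
    σ[mP]≡SQ+SP = begin
      1 * σ (m * P)  ≡⟨ *-identityˡ (σ (m * P)) ⟩
      σ (m * P)      ≡⟨ σ-multiplicative m P m⊥P ⟩
      S * σ P        ≡⟨ cong (S *_) σ[P]≡P+Q ⟩
      S * (P + Q)    ≡⟨ *-distribˡ-+ S P Q ⟩
      S * P + S * Q  ≡⟨ +-comm (S * P) (S * Q) ⟩
      S * Q + S * P  ∎
      where open ≡-Reasoning

    2mP≡Pδ+SP : 1 * (2 * (m * P)) ≡ P * δ + S * P
    2mP≡Pδ+SP = begin
      1 * (2 * (m * P))  ≡⟨ trans (*-identityˡ (2 * (m * P))) (sym (*-assoc 2 m P)) ⟩
      2 * m * P          ≡⟨ cong (_* P) (σ+deficiency≡2n m m-deficient) ⟨
      (S + δ) * P        ≡⟨ trans (*-distribʳ-+ P S δ) (trans (+-comm (S * P) (δ * P)) (cong (_+ S * P) (*-comm δ P))) ⟩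
      P * δ + S * P      ∎
      where open ≡-Reasoning

  abundant-*⇔ : Abundant (m * P) ⇔ frac P Q ℚ.< center m
  abundant-*⇔ = ⇔.trans (scale-shift-<⇔ 1 (S * P) 2mP≡Pδ+SP σ[mP]≡SQ+SP)
    (⇔.trans (⇔.sym (frac-<⇔ P Q S δ)) (<-respʳ-≡⇔ (sym (center≡frac m m-deficient))))

  deficient-*⇔ : Deficient (m * P) ⇔ center m ℚ.< frac P Q
  deficient-*⇔ = ⇔.trans (scale-shift-<⇔ 1 (S * P) σ[mP]≡SQ+SP 2mP≡Pδ+SP)
    (⇔.trans (⇔.sym (frac-<⇔ S δ P Q)) (<-respˡ-≡⇔ (sym (center≡frac m m-deficient))))

  private
    2MP-scaled : ∀ q t M → m ≡ q * M → q * (1 + t) * (2 * (M * P)) ≡ P * (δ * t + 2 * m) + t * S * P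
    2MP-scaled q t M m≡qM = begin
      q * (1 + t) * (2 * (M * P))               ≡⟨ regroup q (1 + t) M P ⟩
      (1 + t) * (2 * (q * M)) * P               ≡⟨ cong (λ x → (1 + t) * (2 * x) * P) m≡qM ⟨
      (1 + t) * (2 * m) * P                     ≡⟨ cong (λ x → (1 + t) * x * P) (σ+deficiency≡2n m m-deficient) ⟨
      (1 + t) * (S + δ) * P                     ≡⟨ expand t S δ P ⟩
      P * (δ * t + (S + δ)) + t * S * P         ≡⟨ cong (λ x → P * (δ * t + x) + t * S * P) (σ+deficiency≡2n m m-deficient) ⟩
      P * (δ * t + 2 * m) + t * S * P           ∎
      where
      open ≡-Reasoning
      regroup : ∀ q u M P → q * u * (2 * (M * P)) ≡ u * (2 * (q * M)) * P
      regroup = solve-∀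
      expand : ∀ t S δ P → (1 + t) * (S + δ) * P ≡ P * (δ * t + (S + δ)) + t * S * P
      expand = solve-∀

    σ[MP]-scaled : ∀ {q α m′} → Prime q → m ≡ q ^ suc α * m′ → ¬ q ∣ m′ → let t = q * σ (q ^ α) in
      q * (1 + t) * σ (q ^ α * m′ * P) ≡ S * t * Q + t * S * P
    σ[MP]-scaled {q} {α} {m′} q-prime m≡q^[1+α]m′ q∤m′ = begin
      q * (1 + t) * σ (M * P)                   ≡⟨ cong (q * (1 + t) *_) σ[MP]≡σM*[P+Q] ⟩
      q * (1 + t) * (σ M * (P + Q))             ≡⟨ cong (λ x → q * x * (σ M * (P + Q))) (σ[p^[1+k]]≡1+p*σ[p^k] q-prime α) ⟨
      q * σ (q ^ suc α) * (σ M * (P + Q))       ≡⟨ regroup q (σ (q ^ suc α)) (σ M) (P + Q) ⟩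
      q * (σ (q ^ suc α) * σ M) * (P + Q)
        ≡⟨ cong (λ x → q * x * (P + Q)) (σ[q^[1+α]]σ[q^αn]≡σ[q^α]σ[q^[1+α]n] {q} {m′} α q-prime q∤m′) ⟩
      q * (σ (q ^ α) * σ (q ^ suc α * m′)) * (P + Q) ≡⟨ cong (λ n → q * (σ (q ^ α) * σ n) * (P + Q)) m≡q^[1+α]m′ ⟨
      q * (σ (q ^ α) * S) * (P + Q)             ≡⟨ expand q (σ (q ^ α)) S P Q ⟩
      S * t * Q + t * S * P                     ∎
      where
      open ≡-Reasoning
      t = q * σ (q ^ α)
      M = q ^ α * m′
      instance
        _ = m^n≢0 q α {{prime⇒nonZero q-prime}}
        _ = ∣⇒nonZero {m′} {m} (divides (q ^ suc α) m≡q^[1+α]m′)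
      regroup : ∀ q a b c → q * a * (b * c) ≡ q * (a * b) * c
      regroup = solve-∀
      expand : ∀ q s S P Q → q * (s * S) * (P + Q) ≡ S * (q * s) * Q + q * s * S * P
      expand = solve-∀
      M⊥P : Coprime M P
      M⊥P = ∣-coprime m⊥P (divides q (trans m≡q^[1+α]m′ (*-assoc q (q ^ α) m′))) ∣-refl
      σ[MP]≡σM*[P+Q] : σ (M * P) ≡ σ M * (P + Q)
      σ[MP]≡σM*[P+Q] = trans (σ-multiplicative M P {{m*n≢0 (q ^ α) m′}} M⊥P) (cong (σ M *_) σ[P]≡P+Q)

  -- With t = q σ(q^α) = σ(q^(α+1)) − 1, multiplying the deficiency inequality for (m/q) P by
  -- q (1 + t) and using σ(q^(α+1)) σ(m/q) = σ(q^α) σ(m) gives σ(m) t Q < P (d(m) t + 2m).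
  deficient-cofactor⇔ : ∀ {q α m′} → Prime q → m ≡ q ^ suc α * m′ → ¬ q ∣ m′ →
    Deficient (q ^ α * m′ * P) ⇔
    ⟦ σ m ⟧ // (defi m ℚ.+ (⟦ 2 * m ⟧ // (⟦ σ (q ^ suc α) ⟧ ℚ.- ⟦ 1 ⟧))) ℚ.< frac P Q
  deficient-cofactor⇔ {q} {α} {m′} q-prime m≡q^[1+α]m′ q∤m′ =
    ⇔.trans (scale-shift-<⇔ (q * (1 + t)) (t * S * P)
               (σ[MP]-scaled {q} {α} {m′} q-prime m≡q^[1+α]m′ q∤m′)
               (2MP-scaled q t (q ^ α * m′) (trans m≡q^[1+α]m′ (*-assoc q (q ^ α) m′))))
    (⇔.trans (⇔.sym (frac-<⇔ (S * t) (δ * t + 2 * m) P Q))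
             (<-respˡ-≡⇔ (sym (conditionB-bound≡frac m α m-deficient q-prime))))
    where
    t = q * σ (q ^ α)
    instance
      _ = prime⇒nonZero q-prime
      _ = m*n≢0 q (1 + t)
      _ = >-nonZero (<-≤-trans (>-nonZero⁻¹ (2 * m) {{m*n≢0 2 m}}) (m≤n+m (2 * m) (δ * t)))

  primeCofactors⇔conditionB :
    (∀ r k → Prime r → m ≡ r * k → Deficient (k * P)) ⇔ ConditionB m (frac P Q)
  primeCofactors⇔conditionB = mk⇔ to from
    where
    to : (∀ r k → Prime r → m ≡ r * k → Deficient (k * P)) → ConditionB m (frac P Q)
    to cofactors q (suc α) q-prime _ q^[1+α]∥m =
      let m′ , m≡q^[1+α]m′ , q∤m′ = ∥⇒exact {q} {suc α} q^[1+α]∥m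
      in Equivalence.to (deficient-cofactor⇔ {q} {α} {m′} q-prime m≡q^[1+α]m′ q∤m′)
           (cofactors q (q ^ α * m′) q-prime (trans m≡q^[1+α]m′ (*-assoc q (q ^ α) m′)))
    from : ConditionB m (frac P Q) → ∀ r k → Prime r → m ≡ r * k → Deficient (k * P)
    from conditionB r k r-prime m≡rk = from-exact-power (exact-power r-prime m)
      where
      instance _ = prime⇒nonZero r-prime
      from-exact-power : (∃₂ λ α m′ → m ≡ r ^ α * m′ × ¬ r ∣ m′) → Deficient (k * P)
      from-exact-power (zero , m′ , m≡1*m′ , r∤m′) =
        ⊥-elim (r∤m′ (divides k (trans (sym (trans m≡1*m′ (*-identityˡ m′))) (trans m≡rk (*-comm r k)))))
      from-exact-power (suc α , m′ , m≡r^[1+α]m′ , r∤m′) = subst (λ x → Deficient (x * P)) (sym k≡r^αm′)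
        (Equivalence.from (deficient-cofactor⇔ {r} {α} {m′} r-prime m≡r^[1+α]m′ r∤m′)
          (conditionB r (suc α) r-prime (s≤s z≤n) (exact⇒∥ {r} {suc α} m≡r^[1+α]m′ r∤m′)))
        where
        k≡r^αm′ : k ≡ r ^ α * m′
        k≡r^αm′ = *-cancelˡ-≡ k (r ^ α * m′) r (trans (sym m≡rk) (trans m≡r^[1+α]m′ (*-assoc r (r ^ α) m′)))

primePower-cofactors⇔ : ∀ {p} e (A : ℕ → Set) → Prime p →
  (∀ r k → Prime r → p ^ suc e ≡ r * k → A k) ⇔ A (p ^ e)
primePower-cofactors⇔ {p} e A p-prime = mk⇔
  (λ cofactors → cofactors p (p ^ e) p-prime refl)
  (λ A[p^e] r k r-prime p^[1+e]≡rk →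
    let _ , k≡p^e = p^[1+e]≡r*k⇒r≡p×k≡p^e e p-prime r-prime p^[1+e]≡rk in subst A (sym k≡p^e) A[p^e])

deficient-m*p^e⇔conditionC : ∀ {m p} e → Deficient m → Prime p → Coprime m p →
  Deficient (m * p ^ e) ⇔ (suc e ≡ 1 ⊎ center m ℚ.< frac (p ^ e) (σ (p ^ (e ∸ 1))))
deficient-m*p^e⇔conditionC {m} zero m-deficient _ _ =
  mk⇔ (λ _ → inj₁ refl) (λ _ → subst Deficient (sym (*-identityʳ m)) m-deficient)
deficient-m*p^e⇔conditionC {m} {p} (suc e) m-deficient p-prime m⊥p = ⇔.trans
  (deficient-*⇔ {{m^n≢0 p (suc e)}} {{σ≢0 (p ^ e) {{m^n≢0 p e}}}}
    m-deficient (coprime-^ʳ m⊥p (suc e)) (σ[p^[1+k]]≡p^[1+k]+σ[p^k] p-prime e))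
  (mk⇔ inj₂ [ (λ ()) , id ])
  where instance _ = prime⇒nonZero p-prime

theorem2p8 : (m e p : ℕ) → Deficient m → 1 ≤ e → Prime p → gcd m p ≡ 1 →
    (PrimitiveAbundant (m * p ^ e) ⇔
      ((⟦ p ^ e ⟧ // ⟦ σ (p ^ (e ∸ 1)) ⟧ ℚ.< center m)
      × (∀ q α → Prime q → 1 ≤ α → q ^ α ∥ m →
           ⟦ σ m ⟧ // (defi m ℚ.+ (⟦ 2 * m ⟧ // (⟦ σ (q ^ α) ⟧ ℚ.- ⟦ 1 ⟧)))
             ℚ.< ⟦ p ^ e ⟧ // ⟦ σ (p ^ (e ∸ 1)) ⟧)
      × (e ≡ 1 ⊎ center m ℚ.< ⟦ p ^ (e ∸ 1) ⟧ // ⟦ σ (p ^ (e ∸ 2)) ⟧)))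
theorem2p8 m zero p _ () _ _
theorem2p8 m (suc e) p m-deficient _ p-prime gcd[m,p]≡1 =
  ⇔.trans (⇔.refl ×-⇔ properDivisors⇔primeCofactors (m * p ^ suc e))
  (⇔.trans (⇔.refl ×-⇔ primeCofactors-*⇔ m (p ^ suc e))
  (abundant-*⇔ m-deficient m⊥p^[1+e] σ[p^[1+e]]≡p^[1+e]+σ[p^e]
    ×-⇔ primeCofactors⇔conditionB m-deficient m⊥p^[1+e] σ[p^[1+e]]≡p^[1+e]+σ[p^e]
    ×-⇔ ⇔.trans (primePower-cofactors⇔ e (λ k → Deficient (m * k)) p-prime)
                (deficient-m*p^e⇔conditionC e m-deficient p-prime m⊥p)))
  where
  instance
    _ = prime⇒nonZero p-prime
    _ = m^n≢0 p e
    _ = m^n≢0 p (suc e)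
    _ = σ≢0 (p ^ e)
    _ = m*n≢0 m (p ^ suc e) {{deficient⇒nonZero m m-deficient}}
  m⊥p : Coprime m p
  m⊥p = gcd≡1⇒coprime gcd[m,p]≡1
  m⊥p^[1+e] : Coprime m (p ^ suc e)
  m⊥p^[1+e] = coprime-^ʳ m⊥p (suc e)
  σ[p^[1+e]]≡p^[1+e]+σ[p^e] : σ (p ^ suc e) ≡ p ^ suc e + σ (p ^ e)
  σ[p^[1+e]]≡p^[1+e]+σ[p^e] = σ[p^[1+k]]≡p^[1+k]+σ[p^k] p-prime e
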